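{- Let $D=(X,\mathcal{B})$ be a $2$-$(v,k,\lambda)$ design with replication number $r=\frac{\lambda(v-1)}{k-1}$, and suppose $$\gamma(D)<\frac{\left\lceil \frac{r}{\lambda}\right\rceil (k-1)+v}{k}.$$ Then $D$ is a super-neat design. In particular, when $\lambda=1$, $D$ is super-neat if $\gamma(D)<\frac{2v-1}{k}$.
   Context: Let $v,k,\lambda$ be positive integers with $v\geq k\geq 2$. A $2$-$(v,k,\lambda)$ design $D=(X,\mathcal{B})$ consists of a set $X$ of $v$ points and a family $\mathcal{B}$ of $k$-subsets of $X$ (blocks) such that every pair of distinct points is contained in exactly $\lambda$ blocks; every point lies in exactly $r=\lambda(v-1)/(k-1)$ blocks. The incidence graph $G_D$ is the bipartite graph with vertex set $X\cup\mathcal{B}$ in which a point $x$ is adjacent to a block $B$ iff $x\in B$. A dominating set is a set $S$ of vertices such that every vertex not in $S$ is adjacent to some vertex of $S$; $\gamma(D)$ is the minimum size of a dominating set of $G_D$. For $P\subseteq X$, $\hat{L}(P)=\{B\in\mathcal{B}: B\cap P=\emptyset\}$ and $I_P=P\cup\hat{L}(P)$. A set $S\subseteq X\cup\mathcal{B}$ is neat if $S=I_P$ for some $P\subseteq X$ (necessarily $P=S\cap X$). $D$ is super-neat if every dominating set of $G_D$ of size $\gamma(D)$ is neat. -}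

module Defs where

open import Data.Nat using (ℕ; zero; suc; _+_; _*_; _∸_; _≤_; _<_)
open import Data.Nat.DivMod using (_/_)
open import Data.Bool using (_∧_)
open import Data.Fin using (Fin)
open import Data.Fin.Subset using (Subset; _∈_; _∉_; _∩_; ⊥; ∣_∣)
open import Data.Fin.Subset.Properties using (_∈?_)
open import Data.Vec using (tabulate)
open import Data.Product using (Σ; ∃; _×_; _,_)
open import Relation.Nullary using (¬_; does)
open import Relation.Binary.PropositionalEquality using (_≡_)

-- A design with point set Fin v and a (multi)family of b blocks,
-- block j being the subset B j of the points.
Blocks : ℕ → ℕ → Set
Blocks v b = Fin b → Subset v

blocksThrough : ∀ {v b} → Blocks v b → Fin v → Fin v → Subset b
blocksThrough B x y = tabulate (λ j → does (x ∈? B j) ∧ does (y ∈? B j))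

record Is2Design {v b : ℕ} (k lam : ℕ) (B : Blocks v b) : Set where
  field
    two≤k       : 2 ≤ k
    k≤v         : k ≤ v
    1≤λ         : 1 ≤ lam
    blockSize   : ∀ j → ∣ B j ∣ ≡ k
    pairBalance : ∀ x y → ¬ (x ≡ y) → ∣ blocksThrough B x y ∣ ≡ lam

-- natural-number division / ceiling division (division by 0 gives 0; never used)
div : ℕ → ℕ → ℕ
div m zero    = 0
div m (suc n) = m / suc n

ceilDiv : ℕ → ℕ → ℕ
ceilDiv m zero    = 0
ceilDiv m (suc n) = (m + n) / suc n

repl : ℕ → ℕ → ℕ → ℕ
repl v k lam = div (lam * (v ∸ 1)) (k ∸ 1)

-- A vertex set of the incidence graph: a set P of points and a set S of blocks.
-- Dominating: every point outside P lies in a block of S, and every block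
-- outside S contains a point of P.
IsDominating : ∀ {v b} → Blocks v b → Subset v → Subset b → Set
IsDominating {v} {b} B P S =
  (∀ (x : Fin v) → x ∉ P → ∃ λ j → j ∈ S × x ∈ B j) ×
  (∀ (j : Fin b) → j ∉ S → ∃ λ x → x ∈ P × x ∈ B j)

size : ∀ {v b} → Subset v → Subset b → ℕ
size P S = ∣ P ∣ + ∣ S ∣

IsDominationNumber : ∀ {v b} → Blocks v b → ℕ → Set
IsDominationNumber B g =
  (Σ _ λ P → Σ _ λ S → IsDominating B P S × size P S ≡ g) ×
  (∀ P S → IsDominating B P S → g ≤ size P S)

IsNeat : ∀ {v b} → Blocks v b → Subset v → Subset b → Set
IsNeat B P S = ∀ j → (j ∈ S → B j ∩ P ≡ ⊥) × (B j ∩ P ≡ ⊥ → j ∈ S)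

SuperNeat : ∀ {v b} → Blocks v b → Set
SuperNeat B = ∀ g → IsDominationNumber B g →
  ∀ P S → IsDominating B P S → size P S ≡ g → IsNeat B P S

-- A minimum dominating set (P , S) of the incidence graph always contains every block missing P.
-- If some block j₀ ∈ S also met P, then by minimality j₀ would have a private point y ∉ P lying in no
-- other block of S; every block through y would then meet P (j₀ at a point of P, the blocks outside S
-- by domination). Double counting the r blocks through y against the λ blocks through each pair {y , x},
-- x ∈ P, gives r ≤ λ∣P∣, while S covers the points outside P, so v ≤ ∣P∣ + k∣S∣. Together
-- ⌈r/λ⌉(k − 1) + v ≤ k(∣P∣ + ∣S∣) = kγ, against the hypothesis. For λ = 1 the bound is
-- r(k − 1) + v = 2v − 1.
module Submission where

open import Defs
open import Data.Nat using (ℕ; _+_; _*_; _∸_; _<_)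
open import Data.Product using (_×_)
open import Relation.Binary.PropositionalEquality using (_≡_)

open import Data.Bool using (Bool; true; false; _∧_)
open import Data.Fin using (Fin; zero; suc; punchIn; _≟_)
open import Data.Fin.Properties using (any?; punchInᵢ≢i)
open import Data.Fin.Subset using (Subset; _∈_; _∉_; _∩_; _-_; ∣_∣; inside; outside) renaming (⊥ to ∅)
open import Data.Fin.Subset.Properties
  using (_∈?_; nonempty?; Empty-unique; x∈p∩q⁺; x∈p∩q⁻; ∉⊥; x∈p∧x≢y⇒x∈p-y; x∈p⇒∣p-x∣<∣p∣)
open import Data.Nat using (zero; suc; _≤_; z≤n; s≤s; s≤s⁻¹)
open import Data.Nat.DivMod using (m<n*o⇒m/o<n; m*n/n≡m; n/1≡n)
open import Data.Nat.Properties hiding (_≟_)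
open import Algebra.Properties.Semiring.Sum +-*-semiring
  using (sum; sum-syntax; ∑-comm; ∑-distrib-+; *-distribˡ-sum; *-distribʳ-sum; sum-remove; sum-cong-≗)
open import Data.Nat.Solver using (module +-*-Solver)
open import Data.Product using (∃; _,_)
open import Data.Vec using ([]; _∷_; tabulate)
open import Function using (_∘_)
open import Relation.Binary.PropositionalEquality using (_≢_; refl; sym; trans; cong; cong₂; subst; module ≡-Reasoning)
open import Relation.Nullary using (Dec; yes; no; does; ¬?; _×-dec_; contradiction)
open import Relation.Nullary.Decidable using (decidable-stable)

open +-*-Solver using (solve; _:+_; _:*_; _:=_; con)

𝟙 : Bool → ℕ
𝟙 true  = 1
𝟙 false = 0

𝟙-∧ : ∀ a c → 𝟙 (a ∧ c) ≡ 𝟙 a * 𝟙 c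
𝟙-∧ true  c = sym (+-identityʳ (𝟙 c))
𝟙-∧ false c = refl

χ : ∀ {n} → Subset n → Fin n → ℕ
χ p i = 𝟙 (does (i ∈? p))

module _ {n} {p : Subset n} {x : Fin n} where

  χ-∈ : x ∈ p → χ p x ≡ 1
  χ-∈ x∈p with x ∈? p
  ... | yes _  = refl
  ... | no x∉p = contradiction x∈p x∉p

  χ*-mono : ∀ {m m′} → (x ∈ p → m ≤ m′) → χ p x * m ≤ χ p x * m′
  χ*-mono m≤m′ with x ∈? p
  ... | yes x∈p = *-monoʳ-≤ 1 (m≤m′ x∈p)
  ... | no _    = z≤n

  χ*-cong : ∀ {m m′} → (x ∈ p → m ≡ m′) → χ p x * m ≡ χ p x * m′
  χ*-cong m≡m′ with x ∈? p
  ... | yes x∈p = cong (1 *_) (m≡m′ x∈p)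
  ... | no _    = refl

∣p∣≡∑χ : ∀ {n} (p : Subset n) → ∣ p ∣ ≡ ∑[ i < n ] χ p i
∣p∣≡∑χ []            = refl
∣p∣≡∑χ (inside  ∷ p) = cong suc (∣p∣≡∑χ p)
∣p∣≡∑χ (outside ∷ p) = ∣p∣≡∑χ p

∣tabulate∣≡∑ : ∀ {n} (f : Fin n → Bool) → ∣ tabulate f ∣ ≡ ∑[ i < n ] 𝟙 (f i)
∣tabulate∣≡∑ {zero}  f = refl
∣tabulate∣≡∑ {suc n} f with f zero
... | true  = cong suc (∣tabulate∣≡∑ (f ∘ suc))
... | false = ∣tabulate∣≡∑ (f ∘ suc)

∑-mono-≤ : ∀ {n} {f g : Fin n → ℕ} → (∀ i → f i ≤ g i) → sum f ≤ sum g
∑-mono-≤ {zero}  f≤g = z≤n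
∑-mono-≤ {suc n} f≤g = +-mono-≤ (f≤g zero) (∑-mono-≤ (f≤g ∘ suc))

≤-∑ : ∀ {n} (f : Fin n → ℕ) i → f i ≤ sum f
≤-∑ f zero    = m≤m+n _ _
≤-∑ f (suc i) = ≤-trans (≤-∑ (f ∘ suc) i) (m≤n+m _ _)

∑-const : ∀ n c → ∑[ i < n ] c ≡ n * c
∑-const zero    c = refl
∑-const (suc n) c = cong (c +_) (∑-const n c)

*∣p∣≡∑ : ∀ {n} c (p : Subset n) → c * ∣ p ∣ ≡ ∑[ i < n ] (c * χ p i)
*∣p∣≡∑ c p = trans (cong (c *_) (∣p∣≡∑χ p)) (*-distribˡ-sum c (χ p))

∣p∣*≡∑ : ∀ {n} (p : Subset n) c → ∣ p ∣ * c ≡ ∑[ i < n ] (χ p i * c)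
∣p∣*≡∑ p c = trans (cong (_* c) (∣p∣≡∑χ p)) (*-distribʳ-sum c (χ p))

-- punchIn y enumerates the elements of Fin (suc n) other than y.
∑χ∘punchIn : ∀ {n} {p : Subset (suc n)} {y} → y ∈ p → ∑[ i < n ] χ p (punchIn y i) ≡ ∣ p ∣ ∸ 1
∑χ∘punchIn {n} {p} {y} y∈p = begin
  ∑[ i < n ] χ p (punchIn y i)              ≡⟨ sym (m+n∸m≡n 1 _) ⟩
  1 + ∑[ i < n ] χ p (punchIn y i) ∸ 1      ≡⟨ cong (λ c → c + ∑[ i < n ] χ p (punchIn y i) ∸ 1) (sym (χ-∈ y∈p)) ⟩
  χ p y + ∑[ i < n ] χ p (punchIn y i) ∸ 1  ≡⟨ cong (_∸ 1) (sym (trans (∣p∣≡∑χ p) (sum-remove {i = y} (χ p)))) ⟩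
  ∣ p ∣ ∸ 1                                 ∎
  where open ≡-Reasoning

div-exact : ∀ {m n d} → 1 ≤ n → m ≡ d * n → div m n ≡ d
div-exact {n = suc n} {d} _ refl = m*n/n≡m d (suc n)

ceilDiv-≤ : ∀ {m n p} → 1 ≤ n → m ≤ p * n → ceilDiv m n ≤ p
ceilDiv-≤ {m} {suc l} {p} _ m≤p*n = s≤s⁻¹ (m<n*o⇒m/o<n (begin-strict
  m + l          ≤⟨ +-monoˡ-≤ l m≤p*n ⟩
  p * suc l + l  ≡⟨ +-comm (p * suc l) l ⟩
  l + p * suc l  <⟨ n<1+n _ ⟩
  suc p * suc l  ∎))
  where open ≤-Reasoning

*[k∸1]+[+*k] : ∀ {k} → 1 ≤ k → ∀ p s → p * (k ∸ 1) + (p + s * k) ≡ (p + s) * k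
*[k∸1]+[+*k] {suc k} _ p s =
  solve 3 (λ p s k → p :* k :+ (p :+ s :* (con 1 :+ k)) := (p :+ s) :* (con 1 :+ k)) refl p s k

module _ {v b} (B : Blocks v b) where

  degree : Fin v → ℕ
  degree y = ∑[ j < b ] χ (B j) y

  BlocksThroughMeet : Subset v → Fin v → Set
  BlocksThroughMeet P y = ∀ j → y ∈ B j → ∃ λ x → x ∈ P × x ∈ B j

  BlockMinimal : Subset v → Subset b → Set
  BlockMinimal P S = ∀ S′ → IsDominating B P S′ → ∣ S ∣ ≤ ∣ S′ ∣

  ∣blocksThrough∣≡∑ : ∀ x y → ∣ blocksThrough B x y ∣ ≡ ∑[ j < b ] (χ (B j) x * χ (B j) y)
  ∣blocksThrough∣≡∑ x y = trans (∣tabulate∣≡∑ (λ j → does (x ∈? B j) ∧ does (y ∈? B j)))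
                                (sum-cong-≗ λ j → 𝟙-∧ (does (x ∈? B j)) (does (y ∈? B j)))

  covering-bound : ∀ {k P S} → (∀ j → ∣ B j ∣ ≤ k) → (∀ x → x ∉ P → ∃ λ j → j ∈ S × x ∈ B j) →
    v ≤ ∣ P ∣ + ∣ S ∣ * k
  covering-bound {k} {P} {S} ∣Bj∣≤k covered = begin
    v
      ≡⟨ sym (trans (∑-const v 1) (*-identityʳ v)) ⟩
    ∑[ x < v ] 1
      ≤⟨ ∑-mono-≤ counted ⟩
    ∑[ x < v ] (χ P x + ∑[ j < b ] (χ S j * χ (B j) x))
      ≡⟨ ∑-distrib-+ (χ P) _ ⟩
    ∑[ x < v ] χ P x + ∑[ x < v ] ∑[ j < b ] (χ S j * χ (B j) x)
      ≡⟨ cong₂ _+_ (sym (∣p∣≡∑χ P)) (∑-comm (λ x j → χ S j * χ (B j) x)) ⟩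
    ∣ P ∣ + ∑[ j < b ] ∑[ x < v ] (χ S j * χ (B j) x)
      ≡⟨ cong (∣ P ∣ +_) (sum-cong-≗ λ j → sym (*∣p∣≡∑ (χ S j) (B j))) ⟩
    ∣ P ∣ + ∑[ j < b ] (χ S j * ∣ B j ∣)
      ≤⟨ +-monoʳ-≤ ∣ P ∣ (∑-mono-≤ λ j → *-monoʳ-≤ (χ S j) (∣Bj∣≤k j)) ⟩
    ∣ P ∣ + ∑[ j < b ] (χ S j * k)
      ≡⟨ cong (∣ P ∣ +_) (sym (∣p∣*≡∑ S k)) ⟩
    ∣ P ∣ + ∣ S ∣ * k ∎
    where
    open ≤-Reasoning
    counted : ∀ x → 1 ≤ χ P x + ∑[ j < b ] (χ S j * χ (B j) x)
    counted x with x ∈? P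
    ... | yes _  = s≤s z≤n
    ... | no x∉P with covered x x∉P
    ...   | j , j∈S , x∈Bj = ≤-trans (≤-reflexive (sym (cong₂ _*_ (χ-∈ j∈S) (χ-∈ x∈Bj)))) (≤-∑ _ j)

  degree-bound : ∀ {lam P y} → (∀ z → y ≢ z → ∣ blocksThrough B y z ∣ ≤ lam) → y ∉ P →
    BlocksThroughMeet P y → degree y ≤ ∣ P ∣ * lam
  degree-bound {lam} {P} {y} ∣blocksThrough∣≤lam y∉P meets-P = begin
    ∑[ j < b ] χ (B j) y                                     ≤⟨ ∑-mono-≤ counted ⟩
    ∑[ j < b ] ∑[ z < v ] (χ P z * (χ (B j) y * χ (B j) z))  ≡⟨ ∑-comm (λ j z → χ P z * (χ (B j) y * χ (B j) z)) ⟩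
    ∑[ z < v ] ∑[ j < b ] (χ P z * (χ (B j) y * χ (B j) z))  ≡⟨ sum-cong-≗ (sym ∘ χP*∣blocksThrough∣) ⟩
    ∑[ z < v ] (χ P z * ∣ blocksThrough B y z ∣)             ≤⟨ ∑-mono-≤ (λ z → χ*-mono (∣blocksThrough∣≤lam z ∘ y≢point-of-P)) ⟩
    ∑[ z < v ] (χ P z * lam)                                 ≡⟨ sym (∣p∣*≡∑ P lam) ⟩
    ∣ P ∣ * lam                                              ∎
    where
    open ≤-Reasoning
    y≢point-of-P : ∀ {z} → z ∈ P → y ≢ z
    y≢point-of-P z∈P refl = y∉P z∈P
    χP*∣blocksThrough∣ : ∀ z → χ P z * ∣ blocksThrough B y z ∣ ≡ ∑[ j < b ] (χ P z * (χ (B j) y * χ (B j) z))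
    χP*∣blocksThrough∣ z = trans (cong (χ P z *_) (∣blocksThrough∣≡∑ y z))
                                 (*-distribˡ-sum (χ P z) (λ j → χ (B j) y * χ (B j) z))
    counted : ∀ j → χ (B j) y ≤ ∑[ z < v ] (χ P z * (χ (B j) y * χ (B j) z))
    counted j with y ∈? B j
    ... | no _     = z≤n
    ... | yes y∈Bj with meets-P j y∈Bj
    ...   | x , x∈P , x∈Bj =
      ≤-trans (≤-reflexive (sym (cong₂ (λ a c → a * (1 * c)) (χ-∈ x∈P) (χ-∈ x∈Bj)))) (≤-∑ _ x)

  domination-number-unique : ∀ {g g′} → IsDominationNumber B g → IsDominationNumber B g′ → g ≡ g′
  domination-number-unique ((P , S , dom , refl) , minimum) ((P′ , S′ , dom′ , refl) , minimum′) =
    ≤-antisym (minimum P′ S′ dom′) (minimum′ P S dom)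

  minimum⇒BlockMinimal : ∀ {g P S} → IsDominationNumber B g → IsDominating B P S → size P S ≡ g →
    BlockMinimal P S
  minimum⇒BlockMinimal {P = P} {S} (_ , minimum) _ refl S′ dom′ =
    +-cancelˡ-≤ (∣ P ∣) (∣ S ∣) (∣ S′ ∣) (minimum P S′ dom′)

  CoveredElsewhere : Subset b → Fin b → Fin v → Set
  CoveredElsewhere S j₀ y = ∃ λ j → j ∈ S × y ∈ B j × j ≢ j₀

  coveredElsewhere? : ∀ S j₀ y → Dec (CoveredElsewhere S j₀ y)
  coveredElsewhere? S j₀ y = any? (λ j → (j ∈? S) ×-dec (y ∈? B j) ×-dec ¬? (j ≟ j₀))

  remove-redundant-block : ∀ {P S j₀ x₀} → IsDominating B P S → x₀ ∈ P → x₀ ∈ B j₀ →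
    (∀ y → y ∉ P → y ∈ B j₀ → CoveredElsewhere S j₀ y) → IsDominating B P (S - j₀)
  remove-redundant-block {P} {S} {j₀} {x₀} (covered , meets-P) x₀∈P x₀∈Bj₀ covered-elsewhere =
    covered′ , meets-P′
    where
    covered′ : ∀ y → y ∉ P → ∃ λ j → j ∈ S - j₀ × y ∈ B j
    covered′ y y∉P with covered y y∉P
    ... | j , j∈S , y∈Bj with j ≟ j₀
    ...   | no j≢j₀ = j , x∈p∧x≢y⇒x∈p-y j∈S j≢j₀ , y∈Bj
    ...   | yes refl with covered-elsewhere y y∉P y∈Bj
    ...     | j′ , j′∈S , y∈Bj′ , j′≢j₀ = j′ , x∈p∧x≢y⇒x∈p-y j′∈S j′≢j₀ , y∈Bj′
    meets-P′ : ∀ j → j ∉ S - j₀ → ∃ λ x → x ∈ P × x ∈ B j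
    meets-P′ j j∉S-j₀ with j ≟ j₀
    ... | yes refl = x₀ , x₀∈P , x₀∈Bj₀
    ... | no j≢j₀  = meets-P j (λ j∈S → j∉S-j₀ (x∈p∧x≢y⇒x∈p-y j∈S j≢j₀))

  -- y is a private point of j₀ (in B j₀, outside P, in no other block of S); if none existed,
  -- S - j₀ would still dominate.
  private-point : ∀ {P S j₀ x₀} → IsDominating B P S → BlockMinimal P S → j₀ ∈ S → x₀ ∈ P → x₀ ∈ B j₀ →
    ∃ λ y → y ∉ P × BlocksThroughMeet P y
  private-point {P} {S} {j₀} {x₀} dom@(_ , meets-P) minimal j₀∈S x₀∈P x₀∈Bj₀
    with any? (λ y → ¬? (y ∈? P) ×-dec (y ∈? B j₀) ×-dec ¬? (coveredElsewhere? S j₀ y))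
  ... | yes (y , y∉P , _ , ¬elsewhere) = y , y∉P , meets-P-at-y
    where
    meets-P-at-y : BlocksThroughMeet P y
    meets-P-at-y j y∈Bj with j ∈? S | j ≟ j₀
    ... | yes _   | yes refl = x₀ , x₀∈P , x₀∈Bj₀
    ... | yes j∈S | no j≢j₀  = contradiction (j , j∈S , y∈Bj , j≢j₀) ¬elsewhere
    ... | no j∉S  | _        = meets-P j j∉S
  ... | no ∄private =
    contradiction (minimal (S - j₀) (remove-redundant-block dom x₀∈P x₀∈Bj₀ covered-elsewhere))
                  (<⇒≱ (x∈p⇒∣p-x∣<∣p∣ j₀∈S))
    where
    covered-elsewhere : ∀ y → y ∉ P → y ∈ B j₀ → CoveredElsewhere S j₀ y
    covered-elsewhere y y∉P y∈Bj₀ =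
      decidable-stable (coveredElsewhere? S j₀ y) (λ ¬elsewhere → ∄private (y , y∉P , y∈Bj₀ , ¬elsewhere))

degree*[k∸1]≡λ*[v∸1] : ∀ {v b k lam} {B : Blocks v b} → Is2Design k lam B →
  ∀ y → degree B y * (k ∸ 1) ≡ lam * (v ∸ 1)
degree*[k∸1]≡λ*[v∸1] {suc v′} {b} {k} {lam} {B} D y = begin
  degree B y * (k ∸ 1)
    ≡⟨ *-distribʳ-sum (k ∸ 1) (λ j → χ (B j) y) ⟩
  ∑[ j < b ] (χ (B j) y * (k ∸ 1))
    ≡⟨ sum-cong-≗ (λ j → χ*-cong (other-points j)) ⟩
  ∑[ j < b ] (χ (B j) y * ∑[ i < v′ ] χ (B j) (punchIn y i))
    ≡⟨ sum-cong-≗ (λ j → *-distribˡ-sum (χ (B j) y) (χ (B j) ∘ punchIn y)) ⟩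
  ∑[ j < b ] ∑[ i < v′ ] (χ (B j) y * χ (B j) (punchIn y i))
    ≡⟨ ∑-comm (λ j i → χ (B j) y * χ (B j) (punchIn y i)) ⟩
  ∑[ i < v′ ] ∑[ j < b ] (χ (B j) y * χ (B j) (punchIn y i))
    ≡⟨ sum-cong-≗ (λ i → sym (∣blocksThrough∣≡∑ B y (punchIn y i))) ⟩
  ∑[ i < v′ ] ∣ blocksThrough B y (punchIn y i) ∣
    ≡⟨ sum-cong-≗ (λ i → pairBalance y (punchIn y i) (punchInᵢ≢i y i ∘ sym)) ⟩
  ∑[ i < v′ ] lam
    ≡⟨ trans (∑-const v′ lam) (*-comm v′ lam) ⟩
  lam * v′ ∎
  where
  open Is2Design D
  open ≡-Reasoning
  other-points : ∀ j → y ∈ B j → k ∸ 1 ≡ ∑[ i < v′ ] χ (B j) (punchIn y i)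
  other-points j y∈Bj = trans (cong (_∸ 1) (sym (blockSize j))) (sym (∑χ∘punchIn y∈Bj))

module _ {v b k lam} {B : Blocks v b} (D : Is2Design k lam B) where
  open Is2Design D

  repl≡degree : ∀ y → repl v k lam ≡ degree B y
  repl≡degree y = div-exact (∸-monoˡ-≤ 1 two≤k) (sym (degree*[k∸1]≡λ*[v∸1] D y))

  private-point⇒size-bound : ∀ {P S y} → IsDominating B P S → y ∉ P → BlocksThroughMeet B P y →
    ceilDiv (repl v k lam) lam * (k ∸ 1) + v ≤ size P S * k
  private-point⇒size-bound {P} {S} {y} (covered , _) y∉P meets-P = begin
    ceilDiv (repl v k lam) lam * (k ∸ 1) + v  ≡⟨ cong (λ r → ceilDiv r lam * (k ∸ 1) + v) (repl≡degree y) ⟩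
    ceilDiv (degree B y) lam * (k ∸ 1) + v    ≤⟨ +-mono-≤ (*-monoˡ-≤ (k ∸ 1) ⌈degree/λ⌉≤∣P∣) v≤∣P∣+∣S∣*k ⟩
    ∣ P ∣ * (k ∸ 1) + (∣ P ∣ + ∣ S ∣ * k)     ≡⟨ *[k∸1]+[+*k] (≤-trans (s≤s z≤n) two≤k) ∣ P ∣ ∣ S ∣ ⟩
    (∣ P ∣ + ∣ S ∣) * k                       ∎
    where
    open ≤-Reasoning
    ⌈degree/λ⌉≤∣P∣ : ceilDiv (degree B y) lam ≤ ∣ P ∣
    ⌈degree/λ⌉≤∣P∣ = ceilDiv-≤ 1≤λ (degree-bound B (λ z → ≤-reflexive ∘ pairBalance y z) y∉P meets-P)
    v≤∣P∣+∣S∣*k : v ≤ ∣ P ∣ + ∣ S ∣ * k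
    v≤∣P∣+∣S∣*k = covering-bound B (≤-reflexive ∘ blockSize) covered

  neat-if-small : ∀ {P S} → IsDominating B P S → BlockMinimal B P S →
    size P S * k < ceilDiv (repl v k lam) lam * (k ∸ 1) + v → IsNeat B P S
  neat-if-small {P} {S} dom@(_ , meets-P) minimal small j = ∈S⇒avoids-P , avoids-P⇒∈S
    where
    ∈S⇒avoids-P : j ∈ S → B j ∩ P ≡ ∅
    ∈S⇒avoids-P j∈S with nonempty? (B j ∩ P)
    ... | no empty = Empty-unique empty
    ... | yes (x , x∈Bj∩P) with x∈p∩q⁻ (B j) P x∈Bj∩P
    ...   | x∈Bj , x∈P with private-point B dom minimal j∈S x∈P x∈Bj
    ...     | y , y∉P , meets-P-at-y = contradiction (private-point⇒size-bound dom y∉P meets-P-at-y) (<⇒≱ small)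
    avoids-P⇒∈S : B j ∩ P ≡ ∅ → j ∈ S
    avoids-P⇒∈S Bj∩P≡∅ with j ∈? S
    ... | yes j∈S = j∈S
    ... | no j∉S with meets-P j j∉S
    ...   | x , x∈P , x∈Bj = contradiction (subst (x ∈_) Bj∩P≡∅ (x∈p∩q⁺ (x∈Bj , x∈P))) ∉⊥

  superNeat-if-small : ∀ g → IsDominationNumber B g →
    g * k < ceilDiv (repl v k lam) lam * (k ∸ 1) + v → SuperNeat B
  superNeat-if-small g γ small g′ γ′ P S dom size≡g′ =
    neat-if-small dom (minimum⇒BlockMinimal B γ′ dom size≡g′)
      (subst (λ h → h * k < _) (sym (trans size≡g′ (domination-number-unique B γ′ γ))) small)

size-bound-for-λ≡1 : ∀ {v b k} {B : Blocks v b} → Is2Design k 1 B →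
  ceilDiv (repl v k 1) 1 * (k ∸ 1) + v ≡ 2 * v ∸ 1
size-bound-for-λ≡1 {zero} D = contradiction (≤-trans (Is2Design.two≤k D) (Is2Design.k≤v D)) λ ()
size-bound-for-λ≡1 {suc v′} {k = k} {B} D = begin
  ceilDiv (repl (suc v′) k 1) 1 * (k ∸ 1) + suc v′
    ≡⟨ cong (λ r → r * (k ∸ 1) + suc v′) ⌈r/1⌉≡r ⟩
  repl (suc v′) k 1 * (k ∸ 1) + suc v′
    ≡⟨ cong (λ r → r * (k ∸ 1) + suc v′) (repl≡degree D zero) ⟩
  degree B zero * (k ∸ 1) + suc v′
    ≡⟨ cong (_+ suc v′) (degree*[k∸1]≡λ*[v∸1] D zero) ⟩
  1 * v′ + suc v′
    ≡⟨ solve 1 (λ v′ → con 1 :* v′ :+ (con 1 :+ v′) := v′ :+ (con 1 :+ v′ :+ con 0)) refl v′ ⟩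
  2 * suc v′ ∸ 1 ∎
  where
  open ≡-Reasoning
  ⌈r/1⌉≡r : ceilDiv (repl (suc v′) k 1) 1 ≡ repl (suc v′) k 1
  ⌈r/1⌉≡r = trans (n/1≡n _) (+-identityʳ (repl (suc v′) k 1))

lemma4p1 : ∀ {v b k lam : ℕ} (B : Blocks v b) → Is2Design k lam B →
    (∀ g → IsDominationNumber B g →
      g * k < ceilDiv (repl v k lam) lam * (k ∸ 1) + v → SuperNeat B)
    × (lam ≡ 1 → ∀ g → IsDominationNumber B g → g * k < 2 * v ∸ 1 → SuperNeat B)
lemma4p1 {k = k} B D = superNeat-if-small D , λ { refl g γ small →
  superNeat-if-small D g γ (subst (g * k <_) (sym (size-bound-for-λ≡1 D)) small) }
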